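{- Let $D$ be a digraph on $n$ vertices which either has diameter $2$ or is a bipartite digraph of diameter $3$. Then $c(D)\leq\sqrt{2n}$.
   Context: A digraph has diameter $2$ if for any two vertices $u,v$ there is a directed path from $u$ to $v$ of length at most $2$; a bipartite digraph (vertex set partitioned into two parts with every arc joining the two parts) has diameter $3$ if for any two vertices $u,v$ there is a directed path from $u$ to $v$ of length at most $3$. Cops and Robbers on a digraph $D$: first each of $k$ cops chooses an initial vertex, then the robber chooses one. Then the players alternate, starting with the cops: in a cops' turn every cop either stays or moves from its vertex $x$ to an out-neighbour $y$ (along an arc $x\to y$), and in the robber's turn the robber stays or moves along an arc to an out-neighbour. Several cops may occupy the same vertex; full information. The cops win if, whatever the robber does, after some cops' move some cop occupies the robber's vertex. $c(D)$ is the least $k$ for which the cops win. -}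

module Defs where

open import Data.Nat using (ℕ; zero; suc)
open import Data.Fin using (Fin)
open import Data.Bool using (Bool; T)
open import Data.Product using (Σ; ∃; _×_)
open import Data.Sum using (_⊎_)
open import Relation.Binary.PropositionalEquality using (_≡_; _≢_)

Digraph : ℕ → Set
Digraph n = Fin n → Fin n → Bool

Arc : ∀ {n} → Digraph n → Fin n → Fin n → Set
Arc D u v = T (D u v)

data Walk≤ {n} (D : Digraph n) : ℕ → Fin n → Fin n → Set where
  here : ∀ {m u} → Walk≤ D m u u
  step : ∀ {m u w v} → Arc D u w → Walk≤ D m w v → Walk≤ D (suc m) u v

HasDiameter : ∀ {n} → Digraph n → ℕ → Set
HasDiameter {n} D d = (u v : Fin n) → Walk≤ D d u v

Bipartite : ∀ {n} → Digraph n → Set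
Bipartite {n} D = Σ (Fin n → Bool) λ part →
  (u v : Fin n) → Arc D u v → part u ≢ part v

Move : ∀ {n} → Digraph n → Fin n → Fin n → Set
Move D x y = x ≡ y ⊎ Arc D x y

Cops : ℕ → ℕ → Set
Cops k n = Fin k → Fin n

Caught : ∀ {k n} → Cops k n → Fin n → Set
Caught {k} C r = ∃ λ (i : Fin k) → C i ≡ r

-- CopsWinFrom D C r : it is the cops' turn, cops at C, robber at r, and the
-- cops can force a capture in finitely many rounds whatever the robber does
-- (inductive, so capture happens after finitely many moves).
data CopsWinFrom {n k} (D : Digraph n) : Cops k n → Fin n → Set where
  win : ∀ {C r} (C' : Cops k n) →
        ((i : Fin k) → Move D (C i) (C' i)) →
        (Caught C' r ⊎ ((r' : Fin n) → Move D r r' → CopsWinFrom D C' r')) →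
        CopsWinFrom D C r

CopsWin : ∀ {n} → Digraph n → ℕ → Set
CopsWin {n} D k = Σ (Cops k n) λ C₀ → (r : Fin n) → CopsWinFrom D C₀ r

module Submission where

-- Choose k with k² ≤ 2n and n ≤ S k, where S b = b(b+3)/2.
-- Greedy guarding: while some vertex x has more than b still active vertices
-- in its closed out-neighbourhood N⁺[x], station a permanent guard on x,
-- deactivate N⁺[x] and lower the budget b by one; since S (b+1) = (b+2) + S b
-- the invariant |active| ≤ S b survives.  A guard on x catches the robber as
-- soon as he enters N⁺[x], so the robber may only use active vertices.
-- When the loop stops, every N⁺[r] has at most b active vertices, so b free
-- cops suffice for a chase: one chaser goes after the robber r and each of
-- the other b - 1 cops is assigned to one active escape y ∈ N⁺(r) \ {r}.
-- With diameter 2 every cop reaches, in one move, a vertex adjacent to its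
-- target, so the robber is caught after one round; in the bipartite case a
-- parity argument gives capture within three rounds.

open import Defs
open import Data.Nat using (ℕ; zero; suc; _+_; _*_; _≤_; _<_; z≤n; s≤s; _≤?_; _<?_)
open import Data.Nat.Properties
  using (≤-trans; ≤-antisym; ≤-pred; ≮⇒≥; n≮0; m≤m+n; m≤n+m; n≤1+n; +-suc; *-monoʳ-≤; *-distribˡ-+;
         +-monoʳ-≤; +-monoˡ-≤; +-cancelˡ-≤; module ≤-Reasoning)
open import Data.Nat.Tactic.RingSolver using (solve-∀)
open import Data.Fin using (Fin; zero; suc; splitAt; _↑ˡ_; _↑ʳ_)
open import Data.Fin.Properties using (_≟_; any?)
open import Data.Bool using (Bool; true; false; _∧_; _∨_; not; if_then_else_)
open import Data.Bool.Properties using (¬-not; T-≡) renaming (_≟_ to _≟ᵇ_)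
open import Data.Maybe using (Maybe; just; nothing) renaming (map to mapMaybe)
open import Data.Vec.Functional using (Vector; _∷_; _++_; updateAt)
open import Data.Vec.Functional.Properties
  using (lookup-++ˡ; lookup-++ʳ; updateAt-updates; updateAt-minimal)
open import Data.Product using (Σ; ∃; _×_; _,_; proj₁; proj₂)
open import Data.Sum using (_⊎_; inj₁; inj₂)
open import Data.Empty using (⊥; ⊥-elim)
open import Function using (_∘_; const)
open import Function.Bundles using (Equivalence)
open import Relation.Nullary using (yes; no; does; contradiction)
open import Relation.Nullary.Decidable using (dec-true)
open import Relation.Binary.PropositionalEquality

-- S b = 2 + 3 + … + (b+1) = b(b+3)/2: the number of active vertices a
-- budget of b cops can deal with.
S : ℕ → ℕ
S zero    = 0
S (suc b) = suc (suc b) + S b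

double-S : ∀ k → 2 * S k ≡ k * k + 3 * k
double-S zero    = refl
double-S (suc k) = begin
  2 * (suc (suc k) + S k)            ≡⟨ *-distribˡ-+ 2 (suc (suc k)) (S k) ⟩
  2 * suc (suc k) + 2 * S k          ≡⟨ cong (2 * suc (suc k) +_) (double-S k) ⟩
  2 * suc (suc k) + (k * k + 3 * k)  ≡⟨ expand k ⟩
  suc k * suc k + 3 * suc k          ∎
  where
  open ≡-Reasoning
  expand : ∀ k → 2 * suc (suc k) + (k * k + 3 * k) ≡ suc k * suc k + 3 * suc k
  expand = solve-∀

-- (k+1)² ≤ 2(S k + 1): when n just exceeds S k, the budget k+1 still
-- satisfies (k+1)² ≤ 2n.
square-step : ∀ k → suc k * suc k ≤ 2 * suc (S k)
square-step k = begin
  suc k * suc k            ≡⟨ square k ⟩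
  (k * k + 2 * k) + 1      ≤⟨ +-monoʳ-≤ (k * k + 2 * k) (s≤s z≤n) ⟩
  (k * k + 2 * k) + (2 + k) ≡⟨ regroup k ⟩
  2 + (k * k + 3 * k)      ≡⟨ cong (2 +_) (sym (double-S k)) ⟩
  2 + 2 * S k              ≡⟨ sym (*-distribˡ-+ 2 1 (S k)) ⟩
  2 * suc (S k)            ∎
  where
  open ≤-Reasoning
  square : ∀ k → suc k * suc k ≡ (k * k + 2 * k) + 1
  square = solve-∀
  regroup : ∀ k → (k * k + 2 * k) + (2 + k) ≡ 2 + (k * k + 3 * k)
  regroup = solve-∀

-- Every n has a budget k ≤ √(2n) with n ≤ S k; when n + 1 outgrows S k
-- we must have n = S k, and k + 1 works by square-step.
budget : ∀ n → Σ ℕ λ k → k * k ≤ 2 * n × n ≤ S k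
budget zero = 0 , z≤n , z≤n
budget (suc n) with budget n
... | k , k²≤2n , n≤Sk with suc n ≤? S k
...   | yes n<Sk = k , ≤-trans k²≤2n (*-monoʳ-≤ 2 (n≤1+n n)) , n<Sk
...   | no n≮Sk rewrite ≤-antisym n≤Sk (≮⇒≥ n≮Sk) =
        suc k , square-step k , s≤s (m≤n+m (S k) (suc k))

-- Finite sets of vertices are boolean predicates; count P is |P|.
count : ∀ {n} → (Fin n → Bool) → ℕ
count {zero}  P = 0
count {suc n} P = (if P zero then 1 else 0) + count (P ∘ suc)

count-all : ∀ n → count {n} (const true) ≡ n
count-all zero    = refl
count-all (suc n) = cong suc (count-all n)

count-split : ∀ {n} (P Q : Fin n → Bool) →
  count P ≡ count (λ y → P y ∧ Q y) + count (λ y → P y ∧ not (Q y))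
count-split {zero}  P Q = refl
count-split {suc n} P Q with P zero | Q zero
... | false | _     = count-split (P ∘ suc) (Q ∘ suc)
... | true  | true  = cong suc (count-split (P ∘ suc) (Q ∘ suc))
... | true  | false = trans (cong suc (count-split (P ∘ suc) (Q ∘ suc)))
                           (sym (+-suc (count (λ y → P (suc y) ∧ Q (suc y))) _))

count-remove : ∀ {n} (P : Fin n → Bool) (r : Fin n) → P r ≡ true →
  count P ≡ suc (count (λ y → not (does (r ≟ y)) ∧ P y))
count-remove P zero    Pr rewrite Pr = refl
count-remove P (suc r) Pr =
  trans (cong ((if P zero then 1 else 0) +_) (count-remove (P ∘ suc) r Pr)) (+-suc _ _)

Enumerates : ∀ {n f} → (Fin n → Bool) → (Fin f → Maybe (Fin n)) → Set
Enumerates P T = (∀ y → P y ≡ true → ∃ λ j → T j ≡ just y)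
               × (∀ j y → T j ≡ just y → P y ≡ true)

enumerate : ∀ {n f} (P : Fin n → Bool) → count P ≤ f →
  Σ (Fin f → Maybe (Fin n)) (Enumerates P)
enumerate {zero} P _ = const nothing , (λ ()) , (λ _ _ ())
enumerate {suc n} {f} P size with P zero in P₀
enumerate {suc n} {suc f} P (s≤s size) | true with enumerate (P ∘ suc) size
... | T , complete , sound = T′ , complete′ , sound′
  where
  T′ : Fin (suc f) → Maybe (Fin (suc n))
  T′ zero    = just zero
  T′ (suc j) = mapMaybe suc (T j)
  complete′ : ∀ y → P y ≡ true → ∃ λ j → T′ j ≡ just y
  complete′ zero    _  = zero , refl
  complete′ (suc y) Py = let (j , Tj) = complete y Py in suc j , cong (mapMaybe suc) Tj
  sound′ : ∀ j y → T′ j ≡ just y → P y ≡ true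
  sound′ zero .zero refl = P₀
  sound′ (suc j) y T′j with T j in Tj
  sound′ (suc j) .(suc y) refl | just y = sound j y Tj
enumerate {suc n} {f} P size | false with enumerate (P ∘ suc) size
... | T , complete , sound = T′ , complete′ , sound′
  where
  T′ : Fin f → Maybe (Fin (suc n))
  T′ = mapMaybe suc ∘ T
  complete′ : ∀ y → P y ≡ true → ∃ λ j → T′ j ≡ just y
  complete′ zero    Py = contradiction (trans (sym P₀) Py) λ ()
  complete′ (suc y) Py = let (j , Tj) = complete y Py in j , cong (mapMaybe suc) Tj
  sound′ : ∀ j y → T′ j ≡ just y → P y ≡ true
  sound′ j y T′j with T j in Tj
  sound′ j .(suc y) refl | just y = sound j y Tj

TwoMoves : ∀ {n} → Digraph n → Fin n → Fin n → Set
TwoMoves {n} D x y = Σ (Fin n) λ w → Move D x w × Move D w y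

walk⇒twoMoves : ∀ {n} {D : Digraph n} {x y} → Walk≤ D 2 x y → TwoMoves D x y
walk⇒twoMoves {x = x} here                       = x , inj₁ refl , inj₁ refl
walk⇒twoMoves (step {w = w} a here)              = w , inj₂ a , inj₁ refl
walk⇒twoMoves (step {w = w} a (step b here))     = w , inj₂ a , inj₂ b

both-differ : ∀ {a b c : Bool} → a ≢ c → b ≢ c → a ≡ b
both-differ a≢c b≢c = trans (¬-not a≢c) (sym (¬-not b≢c))

module BipartiteWalks {n} (D : Digraph n) (part : Fin n → Bool)
  (bip : ∀ u v → Arc D u v → part u ≢ part v) (diam : HasDiameter D 3) where

  sameSide : ∀ x y → part x ≡ part y → TwoMoves D x y
  sameSide x y same with diam x y
  ... | here                = walk⇒twoMoves {D = D} here
  ... | step a here         = ⊥-elim (bip x y a same)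
  ... | step a (step b here) = walk⇒twoMoves {D = D} (step a (step b here))
  -- A walk of odd length changes side.
  ... | step {w = w} a (step {w = z} b (step c here)) =
        ⊥-elim (bip z y c (trans (both-differ (λ e → bip w z b (sym e)) (bip x w a)) same))

  crossOver : ∀ x y → part x ≢ part y → Σ (Fin n) λ w → Arc D x w × part w ≡ part y
  crossOver x y differ with diam x y
  ... | here            = ⊥-elim (differ refl)
  ... | step {w = w} a _ = w , a , both-differ (λ e → bip x w a (sym e)) (λ e → differ (sym e))

canMove : ∀ {n} → Digraph n → Fin n → Fin n → Bool
canMove D x y = does (x ≟ y) ∨ D x y

canMove-sound : ∀ {n} (D : Digraph n) x y → canMove D x y ≡ true → Move D x y
canMove-sound D x y e with x ≟ y
... | yes x≡y = inj₁ x≡y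
... | no _    = inj₂ (Equivalence.from T-≡ e)

canMove-complete : ∀ {n} (D : Digraph n) {x y} → Move D x y → canMove D x y ≡ true
canMove-complete D {x} (inj₁ refl) rewrite dec-true (x ≟ x) refl = refl
canMove-complete D {x} {y} (inj₂ arc) with x ≟ y
... | yes _ = refl
... | no _  = Equivalence.to T-≡ arc

capture : ∀ {n k} {D : Digraph n} (C : Cops k n) {r} (i : Fin k) →
  Move D (C i) r → CopsWinFrom D C r
capture {D = D} C {r} i m = win C′ moves (inj₁ (i , updateAt-updates i C))
  where
  C′ : Cops _ _
  C′ = updateAt C i (const r)
  moves : ∀ j → Move D (C j) (C′ j)
  moves j with j ≟ i
  ... | yes refl = subst (Move D (C i)) (sym (updateAt-updates i C)) m
  ... | no j≢i   = inj₁ (sym (updateAt-minimal j i C j≢i))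

free-moves : ∀ {n g b} {D : Digraph n} (G : Vector (Fin n) g) {F F′ : Vector (Fin n) b} →
  (∀ j → Move D (F j) (F′ j)) → ∀ i → Move D ((G ++ F) i) ((G ++ F′) i)
free-moves {g = g} G moves i with splitAt g i
... | inj₁ _ = inj₁ refl
... | inj₂ j = moves j

free-capture : ∀ {n g b} {D : Digraph n} (G : Vector (Fin n) g) (F : Vector (Fin n) b) {r} j →
  Move D (F j) r → CopsWinFrom D (G ++ F) r
free-capture {g = g} {D = D} G F {r} j m =
  capture (G ++ F) (g ↑ʳ j) (subst (λ z → Move D z r) (sym (lookup-++ʳ G F j)) m)

Guarded : ∀ {n g} → Digraph n → Vector (Fin n) g → (Fin n → Bool) → Set
Guarded D G A = ∀ y → A y ≡ false → ∃ λ i → Move D (G i) y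

Sparse : ∀ {n} → Digraph n → (Fin n → Bool) → ℕ → Set
Sparse D A b = ∀ r → count (λ y → A y ∧ canMove D r y) ≤ b

record Deployment {n} (D : Digraph n) (k : ℕ) : Set where
  constructor deployment
  field
    {g b}   : ℕ
    g+b≡k   : g + b ≡ k
    guards  : Vector (Fin n) g
    active  : Fin n → Bool
    guarded : Guarded D guards active
    sparse  : Sparse D active b

module GuardPlacement {n} (D : Digraph n) where

  add-guard : ∀ {g} {G : Vector (Fin n) g} {A} x → Guarded D G A →
    Guarded D (x ∷ G) (λ y → A y ∧ not (canMove D x y))
  add-guard {A = A} x guarded y inactive with A y in Ay
  ... | false = let (i , m) = guarded y Ay in suc i , m
  ... | true with canMove D x y in xy
  ...   | true = zero , canMove-sound D x y xy

  remaining : ∀ b (A : Fin n → Bool) x → count A ≤ S (suc b) →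
    suc b < count (λ y → A y ∧ canMove D x y) →
    count (λ y → A y ∧ not (canMove D x y)) ≤ S b
  remaining b A x bound big = +-cancelˡ-≤ (suc (suc b)) _ _ (begin
    suc (suc b) + count outside  ≤⟨ +-monoˡ-≤ (count outside) big ⟩
    count inside + count outside ≡⟨ sym (count-split A (canMove D x)) ⟩
    count A                      ≤⟨ bound ⟩
    S (suc b)                    ∎)
    where
    open ≤-Reasoning
    inside outside : Fin n → Bool
    inside  y = A y ∧ canMove D x y
    outside y = A y ∧ not (canMove D x y)

  placeGuards : ∀ b {g} (G : Vector (Fin n) g) A → Guarded D G A → count A ≤ S b →
    Deployment D (g + b)
  placeGuards b G A guarded bound with any? (λ x → b <? count (λ y → A y ∧ canMove D x y))
  ... | no none = deployment refl G A guarded (λ r → ≮⇒≥ (λ big → none (r , big)))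
  placeGuards zero G A guarded bound | yes (x , big) =
    ⊥-elim (n≮0 (≤-trans big (≤-trans neighbourhood≤A bound)))
    where
    neighbourhood≤A : count (λ y → A y ∧ canMove D x y) ≤ count A
    neighbourhood≤A = subst (count (λ y → A y ∧ canMove D x y) ≤_)
                        (sym (count-split A (canMove D x))) (m≤m+n _ _)
  placeGuards (suc b) {g} G A guarded bound | yes (x , big) =
    subst (Deployment D) (sym (+-suc g b))
      (placeGuards b (x ∷ G) (λ y → A y ∧ not (canMove D x y)) (add-guard x guarded)
        (remaining b A x bound big))

escapes : ∀ {n} → Digraph n → (Fin n → Bool) → Fin n → Fin n → Bool
escapes D A r y = not (does (r ≟ y)) ∧ (A y ∧ canMove D r y)

module Escapes {n} (D : Digraph n) (A : Fin n → Bool) where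

  escape-active : ∀ {r y} → escapes D A r y ≡ true → A y ≡ true
  escape-active {r} {y} esc with r ≟ y | A y
  escape-active ()  | yes _ | _
  escape-active ()  | no _  | false
  escape-active esc | no _  | true = refl

  escape-arc : ∀ {r y} → escapes D A r y ≡ true → Arc D r y
  escape-arc {r} {y} esc with r ≟ y | A y
  escape-arc ()  | yes _  | _
  escape-arc ()  | no _   | false
  escape-arc esc | no _   | true = Equivalence.from T-≡ esc

  stay-or-escape : ∀ {r r′} → A r′ ≡ true → Move D r r′ → r ≡ r′ ⊎ escapes D A r r′ ≡ true
  stay-or-escape Ar′ (inj₁ r≡r′) = inj₁ r≡r′
  stay-or-escape {r} {r′} Ar′ (inj₂ arc) with r ≟ r′
  ... | yes r≡r′ = inj₁ r≡r′
  ... | no _ rewrite Ar′ | Equivalence.to T-≡ arc = inj₂ refl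

  closed-count : ∀ {r} → A r ≡ true →
    count (λ y → A y ∧ canMove D r y) ≡ suc (count (escapes D A r))
  closed-count {r} Ar = count-remove (λ y → A y ∧ canMove D r y) r self
    where
    self : (A r ∧ canMove D r r) ≡ true
    self rewrite Ar | canMove-complete D {r} (inj₁ refl) = refl

  sparse-zero : Sparse D A 0 → ∀ {r} → A r ≡ true → ⊥
  sparse-zero sparse {r} Ar with subst (_≤ 0) (closed-count Ar) (sparse r)
  ... | ()

  escapes-count : ∀ {f} → Sparse D A (suc f) → ∀ {r} → A r ≡ true → count (escapes D A r) ≤ f
  escapes-count sparse {r} Ar = ≤-pred (subst (_≤ _) (closed-count Ar) (sparse r))

module Guarding {n} (D : Digraph n) {g} (G : Vector (Fin n) g) (A : Fin n → Bool)
  (guarded : Guarded D G A) where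

  guard-capture : ∀ {b} (F : Vector (Fin n) b) {y} → A y ≡ false → CopsWinFrom D (G ++ F) y
  guard-capture {b} F {y} Ay =
    let (i , m) = guarded y Ay
    in capture (G ++ F) (i ↑ˡ b) (subst (λ z → Move D z y) (sym (lookup-++ˡ G F i)) m)

  guardedWin : ∀ {b} (F₀ : Vector (Fin n) b) →
    (∀ r → A r ≡ true → CopsWinFrom D (G ++ F₀) r) → CopsWin D (g + b)
  guardedWin F₀ chase = G ++ F₀ , robberAt
    where
    robberAt : ∀ r → CopsWinFrom D (G ++ F₀) r
    robberAt r with A r in Ar
    ... | true  = chase r Ar
    ... | false = guard-capture F₀ Ar

-- The free team is a chaser followed by f helpers; helper j is sent to the
-- j-th escape of the robber.
module Chase {n} (D : Digraph n) {g} (G : Vector (Fin n) g) (A : Fin n → Bool)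
  (guarded : Guarded D G A) {f} (sparse : Sparse D A (suc f)) where

  open Guarding D G A guarded
  open Escapes D A

  targets : ∀ r → A r ≡ true → Σ (Fin f → Maybe (Fin n)) (Enumerates (escapes D A r))
  targets r Ar = enumerate (escapes D A r) (escapes-count sparse Ar)

  Covers : ∀ {r} → A r ≡ true → Vector (Fin n) f → Set
  Covers {r} Ar H = ∀ j y → proj₁ (targets r Ar) j ≡ just y → Move D (H j) y

  escape-capture : ∀ {r} (Ar : A r ≡ true) {H} → Covers Ar H →
    ∀ c y → escapes D A r y ≡ true → CopsWinFrom D (G ++ (c ∷ H)) y
  escape-capture {r} Ar {H} covers c y esc =
    let (j , Tj) = proj₁ (proj₂ (targets r Ar)) y esc
    in free-capture G (c ∷ H) (suc j) (covers j y Tj)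

  chaser-capture : ∀ {c y} (H : Vector (Fin n) f) → Move D c y → CopsWinFrom D (G ++ (c ∷ H)) y
  chaser-capture {c} H = free-capture G (c ∷ H) zero

  round : ∀ {r c H} c′ (H′ : Vector (Fin n) f) → Move D c c′ → (∀ j → Move D (H j) (H′ j)) →
    CopsWinFrom D (G ++ (c′ ∷ H′)) r →
    (∀ y → escapes D A r y ≡ true → CopsWinFrom D (G ++ (c′ ∷ H′)) y) →
    CopsWinFrom D (G ++ (c ∷ H)) r
  round {r} {c} {H} c′ H′ chaser-move helper-moves stay escape =
    win (G ++ (c′ ∷ H′)) (free-moves {D = D} G team-moves) (inj₂ respond)
    where
    team-moves : ∀ j → Move D ((c ∷ H) j) ((c′ ∷ H′) j)
    team-moves zero    = chaser-move
    team-moves (suc j) = helper-moves j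
    respond : ∀ r′ → Move D r r′ → CopsWinFrom D (G ++ (c′ ∷ H′)) r′
    respond r′ m with A r′ in Ar′
    ... | false = guard-capture (c′ ∷ H′) Ar′
    ... | true with stay-or-escape Ar′ m
    ...   | inj₁ refl = stay
    ...   | inj₂ esc  = escape r′ esc

  module Diameter2 (diam : HasDiameter D 2) where

    aim : ∀ x (m : Maybe (Fin n)) →
      Σ (Fin n) λ w → Move D x w × (∀ y → m ≡ just y → Move D w y)
    aim x nothing  = x , inj₁ refl , λ _ ()
    aim x (just y) = let (w , xw , wy) = walk⇒twoMoves (diam x y) in w , xw , λ { _ refl → wy }

    chase : ∀ c H r → A r ≡ true → CopsWinFrom D (G ++ (c ∷ H)) r
    chase c H r Ar with walk⇒twoMoves (diam c r)
    ... | c′ , cc′ , c′r =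
      round c′ H′ cc′ (λ j → proj₁ (proj₂ (aimed j)))
        (chaser-capture H′ c′r) (escape-capture Ar (λ j → proj₂ (proj₂ (aimed j))) c′)
      where
      target : Fin f → Maybe (Fin n)
      target = proj₁ (targets r Ar)
      aimed : ∀ j → Σ (Fin n) λ w → Move D (H j) w × (∀ y → target j ≡ just y → Move D w y)
      aimed j = aim (H j) (target j)
      H′ : Vector (Fin n) f
      H′ j = proj₁ (aimed j)

  -- Bipartite, diameter 3: helpers only approach targets on their own
  -- side; the robber alternates sides, so three rounds suffice.
  module Bipartite3 (part : Fin n → Bool) (bip : ∀ u v → Arc D u v → part u ≢ part v)
    (diam : HasDiameter D 3) where

    open BipartiteWalks D part bip diam

    aim : ∀ x (m : Maybe (Fin n)) →
      Σ (Fin n) λ w → Move D x w × (∀ y → m ≡ just y → part x ≡ part y → Move D w y)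
    aim x nothing = x , inj₁ refl , λ _ ()
    aim x (just y) with part x ≟ᵇ part y
    ... | yes same  = let (w , xw , wy) = sameSide x y same in w , xw , λ { _ refl _ → wy }
    ... | no differ = x , inj₁ refl , λ { _ refl same → ⊥-elim (differ same) }

    close-in : ∀ x y → Σ (Fin n) λ w → Move D x w × (Move D w y ⊎ part w ≡ part y)
    close-in x y with part x ≟ᵇ part y
    ... | yes same  = let (w , xw , wy) = sameSide x y same in w , xw , inj₁ wy
    ... | no differ = let (w , xw , side) = crossOver x y differ in w , inj₂ xw , inj₂ side

    escape-side : ∀ {r y} → escapes D A r y ≡ true → part r ≢ part y
    escape-side {r} {y} esc = bip r y (escape-arc {r} esc)

    finish : ∀ {r} (Ar : A r ≡ true) c H → Covers Ar H → part c ≡ part r →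
      CopsWinFrom D (G ++ (c ∷ H)) r
    finish {r} Ar c H covers same =
      let (w , cw , wr) = sameSide c r same
      in round w H cw (λ _ → inj₁ refl) (chaser-capture H wr) (escape-capture Ar covers w)

    pursue : ∀ {r} (Ar : A r ≡ true) c H → (∀ j → part (H j) ≢ part r) →
      CopsWinFrom D (G ++ (c ∷ H)) r
    pursue {r} Ar c H far with close-in c r
    ... | c′ , cc′ , next =
      round c′ H′ cc′ (λ j → proj₁ (proj₂ (aimed j))) (stay next) (escape-capture Ar covers c′)
      where
      target : Fin f → Maybe (Fin n)
      target = proj₁ (targets r Ar)
      aimed : ∀ j → Σ (Fin n) λ w →
        Move D (H j) w × (∀ y → target j ≡ just y → part (H j) ≡ part y → Move D w y)
      aimed j = aim (H j) (target j)
      H′ : Vector (Fin n) f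
      H′ j = proj₁ (aimed j)
      -- A target is an escape, so it lies opposite r, i.e. on its helper's side.
      covers : Covers Ar H′
      covers j y Tj = proj₂ (proj₂ (aimed j)) y Tj
        (both-differ (far j) (λ e → escape-side {r} (proj₂ (proj₂ (targets r Ar)) j y Tj) (sym e)))
      -- If the robber stays, the chaser catches him now or one round later.
      stay : Move D c′ r ⊎ part c′ ≡ part r → CopsWinFrom D (G ++ (c′ ∷ H′)) r
      stay (inj₁ c′r)  = chaser-capture H′ c′r
      stay (inj₂ side) = finish Ar c′ H′ covers side

    -- All free cops start at v.  If v is on the robber's side, only the
    -- chaser moves; an escape then puts the robber opposite the helpers.
    start : ∀ v r → A r ≡ true → CopsWinFrom D (G ++ (v ∷ const v)) r
    start v r Ar with part v ≟ᵇ part r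
    ... | no differ = pursue Ar v (const v) (λ _ → differ)
    ... | yes same =
      let (w , vw , wr) = sameSide v r same
      in round w (const v) vw (λ _ → inj₁ refl) (chaser-capture (const v) wr)
           (λ y esc → pursue (escape-active {r} esc) w (const v)
                        (λ _ e → escape-side {r} esc (trans (sym same) e)))

open GuardPlacement using (placeGuards)

deploymentWins : ∀ {n} {D : Digraph n} {k} →
  (HasDiameter D 2 ⊎ (Bipartite D × HasDiameter D 3)) → Fin n → Deployment D k → CopsWin D k
deploymentWins {D = D} hyp v (deployment {b = zero} refl G A guarded sparse) =
  Guarding.guardedWin D G A guarded (λ ()) (λ r Ar → ⊥-elim (Escapes.sparse-zero D A sparse Ar))
deploymentWins {D = D} hyp v (deployment {b = suc f} refl G A guarded sparse) =
  Guarding.guardedWin D G A guarded (v ∷ const v) (chase hyp)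
  where
  chase : (HasDiameter D 2 ⊎ (Bipartite D × HasDiameter D 3)) →
    ∀ r → A r ≡ true → CopsWinFrom D (G ++ (v ∷ const v)) r
  chase (inj₁ d2) = Chase.Diameter2.chase D G A guarded sparse d2 v (const v)
  chase (inj₂ ((part , bip) , d3)) = Chase.Bipartite3.start D G A guarded sparse part bip d3 v

theorem12 : (n : ℕ) (D : Digraph n) →
    (HasDiameter D 2 ⊎ (Bipartite D × HasDiameter D 3)) →
    Σ ℕ λ k → (k * k ≤ 2 * n) × CopsWin D k
theorem12 zero    D _ = 0 , z≤n , (λ ()) , (λ ())
theorem12 (suc m) D hyp with budget (suc m)
... | k , k²≤2n , n≤Sk =
  k , k²≤2n , deploymentWins hyp zero
    (placeGuards D k (λ ()) (const true) (λ _ ()) (subst (_≤ S k) (sym (count-all (suc m))) n≤Sk))
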